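{- Let $n\ge 1$ and $1\le k\le n$ be integers and let $d$ be any integer. Then \[ \left\langle {n \atop d} \right\rangle_k = \sum_{j\ge 0} (-1)^{d-j} \binom{n}{d-j}\, j^{k-1}(j+1)^{n-k}, \] where $0^0$ is interpreted as $1$.
   Context: $S_n$ is the set of permutations of $\{1,\dots,n\}$, and a permutation $\pi$ is identified with the sequence $\pi(1),\dots,\pi(n)$. A descent of $\pi$ is an index $i$ with $1\le i\le n-1$ and $\pi(i)>\pi(i+1)$; $\mathrm{Des}(\pi)$ denotes the number of descents. For integers $n,d,k$, $\left\langle {n \atop d} \right\rangle_k$ denotes the number of $\pi\in S_n$ with $\mathrm{Des}(\pi)=d$ and $\pi(1)=k$ (this is $0$ if no such permutation exists, e.g. if $d<0$ or $d\ge n$). Binomial coefficients $\binom{n}{m}$ are $0$ for $m<0$ or $m>n$, so the sum is finite. -}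

module Defs where

open import Data.Nat as ℕ using (ℕ; zero; suc; _<ᵇ_; _≡ᵇ_)
open import Data.Nat.Combinatorics using (_C_)
open import Data.Integer as ℤ using (ℤ; +_; -[1+_]; ∣_∣)
open import Data.Fin using (Fin; toℕ) renaming (_≟_ to _≟F_)
open import Data.Fin.Properties using (all?)
open import Data.Vec using (Vec; []; _∷_; lookup; head)
open import Data.List using (List; []; _∷_; map; allFin; foldr; concatMap; filter; length; upTo; sum)
open import Data.Bool using (Bool; true; false; if_then_else_)
open import Relation.Nullary.Decidable using (Dec; _×-dec_; ⌊_⌋)
open import Relation.Binary.PropositionalEquality using (_≡_)
open import Data.Product using (_×_)

allVecs : (n m : ℕ) → List (Vec (Fin n) m)
allVecs n zero = [] ∷ []
allVecs n (suc m) = concatMap (λ x → map (x ∷_) (allVecs n m)) (allFin n)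

-- A permutation of {1..n} is represented by the sequence π(1),…,π(n),
-- encoded with values in Fin n (value v ∈ Fin n stands for toℕ v + 1).
IsPerm : {n : ℕ} → Vec (Fin n) n → Set
IsPerm {n} v = ∀ i j → lookup v i ≡ lookup v j → i ≡ j

isPerm? : {n : ℕ} → (v : Vec (Fin n) n) → Dec (IsPerm v)
isPerm? {n} v = all? (λ i → all? (λ j → dec i j))
  where
  open import Relation.Nullary.Decidable using (_→-dec_)
  dec : ∀ i j → Dec (lookup v i ≡ lookup v j → i ≡ j)
  dec i j = (lookup v i ≟F lookup v j) →-dec (i ≟F j)

desList : List ℕ → ℕ
desList [] = 0
desList (x ∷ []) = 0
desList (x ∷ y ∷ xs) = (if y <ᵇ x then 1 else 0) ℕ.+ desList (y ∷ xs)

seq : {n m : ℕ} → Vec (Fin n) m → List ℕ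
seq [] = []
seq (x ∷ v) = suc (toℕ x) ∷ seq v

Des : {n : ℕ} → Vec (Fin n) n → ℕ
Des v = desList (seq v)

-- π(1) as a natural number (0 if n = 0, where there is no π(1)).
first : {n : ℕ} → Vec (Fin n) n → ℕ
first {zero} [] = 0
first {suc n} (x ∷ v) = suc (toℕ x)

refinedEulerian : ℕ → ℤ → ℕ → ℕ
refinedEulerian n d k =
  length (filter (λ v → isPerm? v ×-dec (+ (Des v) ℤ.≟ d) ×-dec (first v ℕ.≟ k))
                 (allVecs n n))

-- Binomial coefficient with integer lower index: 0 if m < 0, n C m otherwise
-- (n C m = 0 for m > n already).
binomℤ : ℕ → ℤ → ℤ
binomℤ n (+ m) = + (n C m)
binomℤ n -[1+ m ] = + 0

-- (-1)^e for an integer exponent e (only its parity matters; used with e ≥ 0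
-- whenever the binomial factor is nonzero).
signℤ : ℤ → ℤ
signℤ e = (ℤ.- (+ 1)) ℤ.^ ∣ e ∣

-- Right-hand side: Σ_{j ≥ 0} (-1)^{d-j} C(n, d-j) j^{k-1} (j+1)^{n-k}.
-- Terms with j > |d| vanish (d - j < 0), so the sum is over j = 0..|d|.
-- Natural-number _^_ has 0^0 = 1.
rhs : ℕ → ℤ → ℕ → ℤ
rhs n d k = foldr ℤ._+_ (+ 0) (map term (upTo (suc ∣ d ∣)))
  where
  term : ℕ → ℤ
  term j = signℤ (d ℤ.- + j) ℤ.* binomℤ n (d ℤ.- + j)
           ℤ.* + (j ℕ.^ (k ℕ.∸ 1) ℕ.* (suc j) ℕ.^ (n ℕ.∸ k))

-- Let E n x d count the permutations of Fin (1 + n) with first letter x and d descents.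
-- Deleting the first letter x and standardising the remaining letters (punchIn x preserves
-- their order) gives E (1 + n) x d = Σ_y E n y (d - [y < x]), i.e. in generating functions
-- E (1 + n) x = Σ_y t^[y<x] E n y.  The right-hand side of the theorem is the coefficient of
-- t^d in (1 - t)^(1 + n) Σ_j w(j) t^j with w(j) = j^x (j + 1)^(n - x).  Multiplying by 1 - t
-- takes backward differences, and by the geometric-sum identity (b^m - a^m = Σ a^i b^(m-1-i)
-- for b = a + 1) the difference of w is Σ_y t^[y<x] times the weights for n - 1, so the
-- right-hand side obeys the same recurrence and agrees with E at n = 0.
-- Below, power series are coefficient sequences ℕ → ℤ: shift multiplies by t, Δ by 1 - t,
-- and _⋆_ is the product.
module Submission where

open import Defs
open import Data.Nat using (ℕ; _≤_)
open import Data.Integer using (ℤ; +_)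
open import Relation.Binary.PropositionalEquality using (_≡_)

open import Data.Nat as ℕ using (zero; suc; _∸_; s≤s)
import Data.Nat.Properties as ℕₚ
open import Data.Nat.Combinatorics using (_C_; nCk+nC[k+1]≡[n+1]C[k+1])
open import Data.Integer using (-[1+_])
import Data.Integer.Properties as ℤₚ
open import Data.Bool using (Bool; true; false; if_then_else_)
open import Data.Fin using (Fin; toℕ; fromℕ<)
open import Data.Fin.Properties using (toℕ<n; toℕ-fromℕ<)
open import Data.Product using (_,_)
open import Function using (_∘_)
open import Relation.Binary.PropositionalEquality
  using (refl; sym; trans; cong; cong₂; subst; _≗_; module ≡-Reasoning)
import Algebra.Properties.Semiring.Sum as SemiringSum
open ≡-Reasoning

module ℕ∑ = SemiringSum ℕₚ.+-*-semiring
module ℤ∑ = SemiringSum ℤₚ.+-*-semiring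
open ℕ∑ using () renaming (sum to ∑ℕ)
open ℤ∑ using () renaming (sum to ∑ℤ)

module _ where
  open import Data.Integer using (_+_; _-_; _*_; -_; _^_)
  open import Data.Integer.Tactic.RingSolver using (solve-∀)

  shift : (ℕ → ℤ) → ℕ → ℤ
  shift s zero    = + 0
  shift s (suc d) = s d

  shiftWhen : Bool → (ℕ → ℤ) → ℕ → ℤ
  shiftWhen b s = if b then shift s else s

  shiftWhen-cong : ∀ b {s t} → s ≗ t → shiftWhen b s ≗ shiftWhen b t
  shiftWhen-cong true  s≗t zero    = refl
  shiftWhen-cong true  s≗t (suc d) = s≗t d
  shiftWhen-cong false s≗t         = s≗t

  Δ : (ℕ → ℤ) → ℕ → ℤ
  Δ s d = s d - shift s d

  infixl 7 _⋆_
  _⋆_ : (ℕ → ℤ) → (ℕ → ℤ) → ℕ → ℤ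
  (a ⋆ w) d = ∑ℤ {suc d} λ j → a (d ∸ toℕ j) * w (toℕ j)

  ∑ℤ-sub : ∀ {n} (f g : Fin n → ℤ) → ∑ℤ (λ j → f j - g j) ≡ ∑ℤ f - ∑ℤ g
  ∑ℤ-sub {zero}  f g = refl
  ∑ℤ-sub {suc n} f g =
    trans (cong (_+_ (f Fin.zero - g Fin.zero)) (∑ℤ-sub (f ∘ Fin.suc) (g ∘ Fin.suc)))
          (regroup (f Fin.zero) (g Fin.zero) (∑ℤ (f ∘ Fin.suc)) (∑ℤ (g ∘ Fin.suc)))
    where
    regroup : ∀ x y u v → x - y + (u - v) ≡ x + u - (y + v)
    regroup = solve-∀

  ⋆-congˡ : ∀ {a b} w → a ≗ b → a ⋆ w ≗ b ⋆ w
  ⋆-congˡ w a≗b d = ℤ∑.sum-cong-≗ {suc d} λ j → cong (_* w (toℕ j)) (a≗b (d ∸ toℕ j))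

  ⋆-congʳ : ∀ a {w v} → w ≗ v → a ⋆ w ≗ a ⋆ v
  ⋆-congʳ a w≗v d = ℤ∑.sum-cong-≗ {suc d} λ j → cong (a (d ∸ toℕ j) *_) (w≗v (toℕ j))

  ⋆-subˡ : ∀ a b w d → ((λ i → a i - b i) ⋆ w) d ≡ (a ⋆ w) d - (b ⋆ w) d
  ⋆-subˡ a b w d =
    trans (ℤ∑.sum-cong-≗ {suc d} λ j → distrib (a (d ∸ toℕ j)) (b (d ∸ toℕ j)) (w (toℕ j)))
          (∑ℤ-sub {suc d} (λ j → a (d ∸ toℕ j) * w (toℕ j)) (λ j → b (d ∸ toℕ j) * w (toℕ j)))
    where
    distrib : ∀ x y z → (x - y) * z ≡ x * z - y * z
    distrib = solve-∀

  ⋆-subʳ : ∀ a w v d → (a ⋆ (λ j → w j - v j)) d ≡ (a ⋆ w) d - (a ⋆ v) d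
  ⋆-subʳ a w v d =
    trans (ℤ∑.sum-cong-≗ {suc d} λ j → distrib (a (d ∸ toℕ j)) (w (toℕ j)) (v (toℕ j)))
          (∑ℤ-sub {suc d} (λ j → a (d ∸ toℕ j) * w (toℕ j)) (λ j → a (d ∸ toℕ j) * v (toℕ j)))
    where
    distrib : ∀ x y z → x * (y - z) ≡ x * y - x * z
    distrib = solve-∀

  ⋆-head : ∀ a w d → (a ⋆ w) d ≡ a d * w 0 + shift (a ⋆ (w ∘ suc)) d
  ⋆-head a w zero    = refl
  ⋆-head a w (suc d) = refl

  ⋆-shiftˡ : ∀ a w → shift a ⋆ w ≗ shift (a ⋆ w)
  ⋆-shiftˡ a w zero    = cong (_+ + 0) (ℤₚ.*-zeroˡ (w 0))
  ⋆-shiftˡ a w (suc d) = trans (cong (_+_ (a d * w 0)) (⋆-shiftˡ a (w ∘ suc) d)) (sym (⋆-head a w d))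

  ⋆-shiftʳ : ∀ a w → a ⋆ shift w ≗ shift (a ⋆ w)
  ⋆-shiftʳ a w zero    = cong (_+ + 0) (ℤₚ.*-zeroʳ (a 0))
  ⋆-shiftʳ a w (suc d) = trans (cong (_+ (a ⋆ w) d) (ℤₚ.*-zeroʳ (a (suc d)))) (ℤₚ.+-identityˡ _)

  ⋆-shiftWhenʳ : ∀ a b w → a ⋆ shiftWhen b w ≗ shiftWhen b (a ⋆ w)
  ⋆-shiftWhenʳ a true  w   = ⋆-shiftʳ a w
  ⋆-shiftWhenʳ a false w d = refl

  ⋆-Δˡ : ∀ a w → Δ a ⋆ w ≗ Δ (a ⋆ w)
  ⋆-Δˡ a w d = trans (⋆-subˡ a (shift a) w d) (cong (_-_ ((a ⋆ w) d)) (⋆-shiftˡ a w d))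

  ⋆-Δʳ : ∀ a w → a ⋆ Δ w ≗ Δ (a ⋆ w)
  ⋆-Δʳ a w d = trans (⋆-subʳ a w (shift w) d) (cong (_-_ ((a ⋆ w) d)) (⋆-shiftʳ a w d))

  ⋆-sumʳ : ∀ {n} a (s : Fin n → ℕ → ℤ) →
    a ⋆ (λ j → ∑ℤ λ y → s y j) ≗ λ d → ∑ℤ λ y → (a ⋆ s y) d
  ⋆-sumʳ {n} a s d =
    trans (ℤ∑.sum-cong-≗ {suc d} λ j → ℤ∑.*-distribˡ-sum (a (d ∸ toℕ j)) (λ y → s y (toℕ j)))
          (ℤ∑.∑-comm {suc d} {n} λ j y → a (d ∸ toℕ j) * s y (toℕ j))

  signedBinomial : ℕ → ℕ → ℤ
  signedBinomial n i = (- + 1) ^ i * + (n C i)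

  signedBinomial-suc : ∀ n → signedBinomial (suc n) ≗ Δ (signedBinomial n)
  signedBinomial-suc n zero    = refl
  signedBinomial-suc n (suc i) = begin
    - + 1 * s * + (suc n C suc i)
      ≡⟨ cong (λ c → - + 1 * s * + c) (nCk+nC[k+1]≡[n+1]C[k+1] n i) ⟨
    - + 1 * s * + (n C i ℕ.+ n C suc i)
      ≡⟨ cong (- + 1 * s *_) (ℤₚ.pos-+ (n C i) _) ⟩
    - + 1 * s * (+ (n C i) + + (n C suc i))
      ≡⟨ pascal s _ _ ⟩
    - + 1 * s * + (n C suc i) - s * + (n C i) ∎
    where
    s = (- + 1) ^ i
    pascal : ∀ s x y → - + 1 * s * (x + y) ≡ - + 1 * s * y - s * x
    pascal = solve-∀

  signedBinomial-zero-⋆ : ∀ w → signedBinomial 0 ⋆ w ≗ w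
  signedBinomial-zero-⋆ w zero    = trans (ℤₚ.+-identityʳ _) (ℤₚ.*-identityˡ (w 0))
  signedBinomial-zero-⋆ w (suc d) = begin
    (- + 1) ^ suc d * + 0 * w 0 + (signedBinomial 0 ⋆ (w ∘ suc)) d
      ≡⟨ cong₂ _+_ (trans (cong (_* w 0) (ℤₚ.*-zeroʳ ((- + 1) ^ suc d))) (ℤₚ.*-zeroˡ (w 0)))
                   (signedBinomial-zero-⋆ (w ∘ suc) d) ⟩
    + 0 + w (suc d)
      ≡⟨ ℤₚ.+-identityˡ _ ⟩
    w (suc d) ∎

  signedBinomial-suc-⋆ : ∀ n w → signedBinomial (suc n) ⋆ w ≗ signedBinomial n ⋆ Δ w
  signedBinomial-suc-⋆ n w d = begin
    (signedBinomial (suc n) ⋆ w) d   ≡⟨ ⋆-congˡ w (signedBinomial-suc n) d ⟩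
    (Δ (signedBinomial n) ⋆ w) d     ≡⟨ ⋆-Δˡ (signedBinomial n) w d ⟩
    Δ (signedBinomial n ⋆ w) d       ≡⟨ ⋆-Δʳ (signedBinomial n) w d ⟨
    (signedBinomial n ⋆ Δ w) d       ∎

module _ where
  open import Data.Nat using (_+_; _*_; _^_; _<ᵇ_)
  open import Data.Nat.Tactic.RingSolver using (solve-∀)
  open import Data.Bool.Properties using (if-eta)

  weight : ℕ → ℕ → ℕ → ℕ
  weight n k j = j ^ (k ∸ 1) * suc j ^ (n ∸ k)

  geometric-sum : ∀ a m → suc a ^ m ≡ a ^ m + ∑ℕ {m} (λ y → a ^ toℕ y * suc a ^ (m ∸ suc (toℕ y)))
  geometric-sum a zero    = refl
  geometric-sum a (suc m) = begin
    suc a ^ m + a * suc a ^ m                ≡⟨ cong (λ t → suc a ^ m + a * t) (geometric-sum a m) ⟩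
    suc a ^ m + a * (a ^ m + S)              ≡⟨ regroup (suc a ^ m) a (a ^ m) S ⟩
    a * a ^ m + (1 * suc a ^ m + a * S)      ≡⟨ cong (λ t → a * a ^ m + (1 * suc a ^ m + t)) a*S ⟩
    a * a ^ m + (1 * suc a ^ m + ∑ℕ {m} (λ y → a ^ suc (toℕ y) * suc a ^ (m ∸ suc (toℕ y)))) ∎
    where
    S = ∑ℕ {m} (λ y → a ^ toℕ y * suc a ^ (m ∸ suc (toℕ y)))
    regroup : ∀ b a x s → b + a * (x + s) ≡ a * x + (1 * b + a * s)
    regroup = solve-∀
    a*S : a * S ≡ ∑ℕ {m} (λ y → a ^ suc (toℕ y) * suc a ^ (m ∸ suc (toℕ y)))
    a*S = trans (ℕ∑.*-distribˡ-sum {m} a (λ y → a ^ toℕ y * suc a ^ (m ∸ suc (toℕ y))))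
                (ℕ∑.sum-cong-≗ {m} λ y → sym (ℕₚ.*-assoc a _ _))

  ∑ℕ-if-<ᵇ : ∀ p q (A B : ℕ → ℕ) →
    ∑ℕ {p + q} (λ y → if toℕ y <ᵇ p then A (toℕ y) else B (toℕ y)) ≡
    ∑ℕ {p} (A ∘ toℕ) + ∑ℕ {q} (λ i → B (p + toℕ i))
  ∑ℕ-if-<ᵇ zero    q A B = refl
  ∑ℕ-if-<ᵇ (suc p) q A B =
    trans (cong (_+_ (A 0)) (∑ℕ-if-<ᵇ p q (A ∘ suc) (B ∘ suc))) (sym (ℕₚ.+-assoc (A 0) _ _))

  -- Expand (a + 1) ^ p = a ^ p + F and (a + 2) ^ q = (a + 1) ^ q + G by geometric-sum.
  weight-suc : ∀ {N p} → p ≤ N → ∀ a →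
    weight (suc N) (suc p) (suc a) ≡
    weight (suc N) (suc p) a + ∑ℕ {N} (λ y → if toℕ y <ᵇ p then weight N (suc (toℕ y)) a
                                                           else weight N (suc (toℕ y)) (suc a))
  weight-suc {p = p} p≤N a with q , refl ← ℕₚ.m≤n⇒∃[o]m+o≡n p≤N rewrite ℕₚ.m+n∸m≡n p q = begin
    b ^ p * c ^ q                              ≡⟨ cong (b ^ p *_) (geometric-sum b q) ⟩
    b ^ p * (b ^ q + G)                        ≡⟨ ℕₚ.*-distribˡ-+ (b ^ p) (b ^ q) G ⟩
    b ^ p * b ^ q + b ^ p * G                  ≡⟨ cong (λ t → t * b ^ q + b ^ p * G) (geometric-sum a p) ⟩
    (a ^ p + F) * b ^ q + b ^ p * G            ≡⟨ regroup (a ^ p) F (b ^ q) (b ^ p * G) ⟩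
    a ^ p * b ^ q + (F * b ^ q + b ^ p * G)    ≡⟨ cong (_+_ (a ^ p * b ^ q)) (cong₂ _+_ F*b^q b^p*G) ⟩
    a ^ p * b ^ q + (∑ℕ {p} (A ∘ toℕ) + ∑ℕ {q} (λ i → B (p + toℕ i)))
      ≡⟨ cong (_+_ (a ^ p * b ^ q)) (∑ℕ-if-<ᵇ p q A B) ⟨
    a ^ p * b ^ q + ∑ℕ {p + q} (λ y → if toℕ y <ᵇ p then A (toℕ y) else B (toℕ y)) ∎
    where
    b = suc a
    c = suc b
    A = λ y → a ^ y * b ^ (p + q ∸ suc y)
    B = λ y → b ^ y * c ^ (p + q ∸ suc y)
    F = ∑ℕ {p} (λ y → a ^ toℕ y * b ^ (p ∸ suc (toℕ y)))
    G = ∑ℕ {q} (λ i → b ^ toℕ i * c ^ (q ∸ suc (toℕ i)))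

    regroup : ∀ x f y g → (x + f) * y + g ≡ x * y + (f * y + g)
    regroup = solve-∀

    F*b^q : F * b ^ q ≡ ∑ℕ {p} (A ∘ toℕ)
    F*b^q = trans (ℕ∑.*-distribʳ-sum {p} (b ^ q) (λ y → a ^ toℕ y * b ^ (p ∸ suc (toℕ y))))
                  (ℕ∑.sum-cong-≗ {p} λ y → begin
      a ^ toℕ y * b ^ (p ∸ suc (toℕ y)) * b ^ q
        ≡⟨ ℕₚ.*-assoc (a ^ toℕ y) _ _ ⟩
      a ^ toℕ y * (b ^ (p ∸ suc (toℕ y)) * b ^ q)
        ≡⟨ cong (a ^ toℕ y *_) (ℕₚ.^-distribˡ-+-* b (p ∸ suc (toℕ y)) q) ⟨
      a ^ toℕ y * b ^ (p ∸ suc (toℕ y) + q)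
        ≡⟨ cong (λ e → a ^ toℕ y * b ^ e) (ℕₚ.+-∸-comm q (toℕ<n y)) ⟨
      A (toℕ y) ∎)

    b^p*G : b ^ p * G ≡ ∑ℕ {q} (λ i → B (p + toℕ i))
    b^p*G = trans (ℕ∑.*-distribˡ-sum {q} (b ^ p) (λ i → b ^ toℕ i * c ^ (q ∸ suc (toℕ i))))
                  (ℕ∑.sum-cong-≗ {q} (term ∘ toℕ))
      where
      exponent : ∀ i → p + q ∸ suc (p + i) ≡ q ∸ suc i
      exponent i = trans (cong (p + q ∸_) (sym (ℕₚ.+-suc p i))) (ℕₚ.[m+n]∸[m+o]≡n∸o p q (suc i))
      term : ∀ i → b ^ p * (b ^ i * c ^ (q ∸ suc i)) ≡ B (p + i)
      term i = begin
        b ^ p * (b ^ i * c ^ (q ∸ suc i))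
          ≡⟨ ℕₚ.*-assoc (b ^ p) _ _ ⟨
        b ^ p * b ^ i * c ^ (q ∸ suc i)
          ≡⟨ cong₂ _*_ (ℕₚ.^-distribˡ-+-* b p i) (cong (c ^_) (exponent i)) ⟨
        B (p + i) ∎

  weight-zero : ∀ n p →
    weight (suc (suc n)) (suc p) 0 ≡
    ∑ℕ {suc n} (λ y → if toℕ y <ᵇ p then 0 else weight (suc n) (suc (toℕ y)) 0)
  weight-zero n zero    = begin
    1 * 1 ^ suc n
      ≡⟨ cong (1 *_) (ℕₚ.^-zeroˡ (suc n)) ⟩
    1
      ≡⟨ cong₂ (λ x y → 1 * x + y) (ℕₚ.^-zeroˡ n) (ℕ∑.sum-replicate-zero n) ⟨
    1 * 1 ^ n + ∑ℕ {n} (λ _ → 0) ∎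
  weight-zero n (suc p) =
    sym (trans (ℕ∑.sum-cong-≗ {n} λ y → if-eta (toℕ y <ᵇ p)) (ℕ∑.sum-replicate-zero n))

module _ where
  open import Data.Integer using (_+_; _-_; _*_)
  open import Data.Integer.Tactic.RingSolver using (solve-∀)
  open import Data.List using (foldr; map; applyUpTo)

  pos-∑ : ∀ {n} (f : Fin n → ℕ) → + ∑ℕ f ≡ ∑ℤ (λ i → + f i)
  pos-∑ {zero}  f = refl
  pos-∑ {suc n} f = trans (ℤₚ.pos-+ (f Fin.zero) _) (cong (_+_ (+ f Fin.zero)) (pos-∑ (f ∘ Fin.suc)))

  Δ-weight : ∀ n (x : Fin (suc (suc n))) →
    Δ (λ j → + weight (suc (suc n)) (suc (toℕ x)) j) ≗
    λ j → ∑ℤ {suc n} λ y →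
      shiftWhen (toℕ y ℕ.<ᵇ toℕ x) (λ i → + weight (suc n) (suc (toℕ y)) i) j
  Δ-weight n x = pointwise
    where
    W = weight (suc (suc n)) (suc (toℕ x))
    V = λ (y : Fin (suc n)) → weight (suc n) (suc (toℕ y))
    b = λ (y : Fin (suc n)) → toℕ y ℕ.<ᵇ toℕ x

    at-zero : ∀ b (v : ℕ → ℕ) → shiftWhen b (λ i → + v i) 0 ≡ + (if b then 0 else v 0)
    at-zero true  v = refl
    at-zero false v = refl

    at-suc : ∀ b (v : ℕ → ℕ) a → shiftWhen b (λ i → + v i) (suc a) ≡ + (if b then v a else v (suc a))
    at-suc true  v a = refl
    at-suc false v a = refl

    cancel : ∀ w s → w + s - w ≡ s
    cancel = solve-∀

    pointwise : ∀ j → Δ (λ i → + W i) j ≡ ∑ℤ λ y → shiftWhen (b y) (λ i → + V y i) j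
    pointwise zero = begin
      + W 0 - + 0
        ≡⟨ ℤₚ.+-identityʳ _ ⟩
      + W 0
        ≡⟨ cong +_ (weight-zero n (toℕ x)) ⟩
      + ∑ℕ (λ y → if b y then 0 else V y 0)
        ≡⟨ pos-∑ (λ y → if b y then 0 else V y 0) ⟩
      ∑ℤ (λ y → + (if b y then 0 else V y 0))
        ≡⟨ ℤ∑.sum-cong-≗ {suc n} (λ y → at-zero (b y) (V y)) ⟨
      ∑ℤ (λ y → shiftWhen (b y) (λ i → + V y i) 0) ∎
    pointwise (suc a) = begin
      + W (suc a) - + W a
        ≡⟨ cong (λ t → + t - + W a) (weight-suc x≤1+n a) ⟩
      + (W a ℕ.+ S) - + W a
        ≡⟨ cong (_- + W a) (ℤₚ.pos-+ (W a) S) ⟩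
      + W a + + S - + W a
        ≡⟨ cancel (+ W a) (+ S) ⟩
      + S
        ≡⟨ pos-∑ (λ y → if b y then V y a else V y (suc a)) ⟩
      ∑ℤ (λ y → + (if b y then V y a else V y (suc a)))
        ≡⟨ ℤ∑.sum-cong-≗ {suc n} (λ y → at-suc (b y) (V y) a) ⟨
      ∑ℤ (λ y → shiftWhen (b y) (λ i → + V y i) (suc a)) ∎
      where
      S = ∑ℕ {suc n} (λ y → if b y then V y a else V y (suc a))
      x≤1+n : toℕ x ≤ suc n
      x≤1+n = ℕₚ.≤-pred (toℕ<n x)

  -- rhs (suc n) (+ d) (suc (toℕ x)), by rhs-pos
  eulerianFormula : (n : ℕ) → Fin (suc n) → ℕ → ℤ
  eulerianFormula n x = signedBinomial (suc n) ⋆ λ j → + weight (suc n) (suc (toℕ x)) j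

  eulerianFormula-zero : ∀ d → eulerianFormula 0 Fin.zero d ≡ Δ (λ _ → + 1) d
  eulerianFormula-zero d =
    trans (signedBinomial-suc-⋆ 0 (λ _ → + 1) d) (signedBinomial-zero-⋆ (Δ (λ _ → + 1)) d)

  eulerianFormula-suc : ∀ n x d →
    eulerianFormula (suc n) x d ≡ ∑ℤ λ y → shiftWhen (toℕ y ℕ.<ᵇ toℕ x) (eulerianFormula n y) d
  eulerianFormula-suc n x d = begin
    (signedBinomial (suc (suc n)) ⋆ W) d
      ≡⟨ signedBinomial-suc-⋆ (suc n) W d ⟩
    (signedBinomial (suc n) ⋆ Δ W) d
      ≡⟨ ⋆-congʳ (signedBinomial (suc n)) (Δ-weight n x) d ⟩
    (signedBinomial (suc n) ⋆ (λ j → ∑ℤ λ y → shiftWhen (b y) (V y) j)) d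
      ≡⟨ ⋆-sumʳ (signedBinomial (suc n)) (λ y → shiftWhen (b y) (V y)) d ⟩
    ∑ℤ (λ y → (signedBinomial (suc n) ⋆ shiftWhen (b y) (V y)) d)
      ≡⟨ ℤ∑.sum-cong-≗ {suc n} (λ y → ⋆-shiftWhenʳ (signedBinomial (suc n)) (b y) (V y) d) ⟩
    ∑ℤ (λ y → shiftWhen (b y) (eulerianFormula n y) d) ∎
    where
    W = λ j → + weight (suc (suc n)) (suc (toℕ x)) j
    V = λ (y : Fin (suc n)) j → + weight (suc n) (suc (toℕ y)) j
    b = λ (y : Fin (suc n)) → toℕ y ℕ.<ᵇ toℕ x

  foldr-applyUpTo : ∀ m (g : ℕ → ℕ) (f : ℕ → ℤ) →
    foldr _+_ (+ 0) (map f (applyUpTo g m)) ≡ ∑ℤ {m} (λ i → f (g (toℕ i)))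
  foldr-applyUpTo zero    g f = refl
  foldr-applyUpTo (suc m) g f = cong (_+_ (f (g 0))) (foldr-applyUpTo m (g ∘ suc) f)

  rhs-pos : ∀ n d k → rhs n (+ d) k ≡ (signedBinomial n ⋆ λ j → + weight n k j) d
  rhs-pos n d k = trans (foldr-applyUpTo (suc d) (λ j → j) term) (ℤ∑.sum-cong-≗ {suc d} λ j →
    cong (λ e → signℤ e * binomℤ n e * + weight n k (toℕ j)) (d-j (toℕ j) (ℕₚ.≤-pred (toℕ<n j))))
    where
    term = λ j → signℤ (+ d - + j) * binomℤ n (+ d - + j) * + weight n k j
    d-j : ∀ j → j ≤ d → + d - + j ≡ + (d ∸ j)
    d-j j j≤d = trans (ℤₚ.[+m]-[+n]≡m⊖n d j) (ℤₚ.⊖-≥ j≤d)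

  rhs-neg : ∀ n m k → rhs n -[1+ m ] k ≡ + 0
  rhs-neg n m k = trans (foldr-applyUpTo (suc (suc m)) (λ j → j) term)
    (trans (ℤ∑.sum-cong-≗ {suc (suc m)} (term-vanishes ∘ toℕ)) (ℤ∑.sum-replicate-zero (suc (suc m))))
    where
    term = λ j → signℤ (-[1+ m ] - + j) * binomℤ n (-[1+ m ] - + j) * + weight n k j
    binom-vanishes : ∀ j → binomℤ n (-[1+ m ] - + j) ≡ + 0
    binom-vanishes zero    = refl
    binom-vanishes (suc j) = refl
    term-vanishes : ∀ j → term j ≡ + 0
    term-vanishes j = begin
      signℤ (-[1+ m ] - + j) * binomℤ n (-[1+ m ] - + j) * + weight n k j
        ≡⟨ cong (λ c → signℤ (-[1+ m ] - + j) * c * + weight n k j) (binom-vanishes j) ⟩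
      signℤ (-[1+ m ] - + j) * + 0 * + weight n k j
        ≡⟨ cong (_* + weight n k j) (ℤₚ.*-zeroʳ (signℤ (-[1+ m ] - + j))) ⟩
      + 0 * + weight n k j
        ≡⟨ ℤₚ.*-zeroˡ (+ weight n k j) ⟩
      + 0 ∎

module _ where
  open import Data.Nat using (_+_)
  open import Data.Vec using (Vec; []; _∷_; map; head)
  open import Data.Vec.Relation.Unary.All using (All; _∷_; all?)
  open import Data.List using (List; []; _∷_; length; filter; concatMap; tabulate; _++_) renaming (map to mapL)
  open import Data.List.Properties using (length-++; filter-++; filter-≐; filter-none)
  open import Data.List.Relation.Unary.All using (universal)
  open import Data.Fin using (punchIn) renaming (_≟_ to _≟ᶠ_)
  open import Data.Fin.Properties using (punchInᵢ≢i)
  open import Data.Product using (_×_; proj₁; proj₂)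
  open import Function.Bundles using (_⇔_; mk⇔; Equivalence)
  open import Relation.Unary using (Pred; Decidable)
  open import Relation.Nullary using (¬_; does; ¬?; _×-dec_)
  open import Relation.Binary.PropositionalEquality using (_≢_)
  open import Level using (Level)

  private
    variable
      ℓ ℓ′ : Level
      A B : Set

  length-filter-++ : ∀ {P : Pred A ℓ} (P? : Decidable P) xs ys →
    length (filter P? (xs ++ ys)) ≡ length (filter P? xs) + length (filter P? ys)
  length-filter-++ P? xs ys = trans (cong length (filter-++ P? xs ys)) (length-++ (filter P? xs))

  length-filter-map : ∀ {P : Pred B ℓ} (P? : Decidable P) (f : A → B) xs →
    length (filter P? (mapL f xs)) ≡ length (filter (P? ∘ f) xs)
  length-filter-map P? f []       = refl
  length-filter-map P? f (x ∷ xs) with does (P? (f x))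
  ... | true  = cong suc (length-filter-map P? f xs)
  ... | false = length-filter-map P? f xs

  length-filter-concatMap : ∀ {n} {P : Pred B ℓ} (P? : Decidable P) (g : A → List B) (f : Fin n → A) →
    length (filter P? (concatMap g (tabulate f))) ≡ ∑ℕ (λ i → length (filter P? (g (f i))))
  length-filter-concatMap {n = zero}  P? g f = refl
  length-filter-concatMap {n = suc n} P? g f = trans (length-filter-++ P? (g (f Fin.zero)) _)
    (cong (_+_ (length (filter P? (g (f Fin.zero))))) (length-filter-concatMap P? g (f ∘ Fin.suc)))

  -- Opaque, so that unification does not unfold count into list operations.
  opaque
    count : ∀ {n m} {P : Pred (Vec (Fin n) m) ℓ} → Decidable P → ℕ
    count {n = n} {m} P? = length (filter P? (allVecs n m))

    refinedEulerian-count : ∀ n d k → refinedEulerian n d k ≡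
      count {n = n} {n} (λ v → isPerm? v ×-dec (+ Des v ℤₚ.≟ d) ×-dec (first v ℕ.≟ k))
    refinedEulerian-count n d k = refl

    count-[] : ∀ {n} {P : Pred (Vec (Fin n) 0) ℓ} (P? : Decidable P) →
      count P? ≡ (if does (P? []) then 1 else 0)
    count-[] P? with does (P? [])
    ... | true  = refl
    ... | false = refl

    count-∷ : ∀ {n m} {P : Pred (Vec (Fin n) (suc m)) ℓ} (P? : Decidable P) →
      count P? ≡ ∑ℕ (λ x → count (λ v → P? (x ∷ v)))
    count-∷ {n = n} {m} P? =
      trans (length-filter-concatMap P? (λ x → mapL (x ∷_) (allVecs n m)) (λ x → x))
            (ℕ∑.sum-cong-≗ {n} λ x → length-filter-map P? (x ∷_) (allVecs n m))

    count-cong : ∀ {n m} {P : Pred (Vec (Fin n) m) ℓ} {Q : Pred (Vec (Fin n) m) ℓ′}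
      (P? : Decidable P) (Q? : Decidable Q) → (∀ v → P v ⇔ Q v) → count P? ≡ count Q?
    count-cong {n = n} {m} P? Q? P⇔Q =
      cong length (filter-≐ P? Q? (Equivalence.to (P⇔Q _) , Equivalence.from (P⇔Q _)) (allVecs n m))

    count-none : ∀ {n m} {P : Pred (Vec (Fin n) m) ℓ} (P? : Decidable P) → (∀ v → ¬ P v) → count P? ≡ 0
    count-none {n = n} {m} P? ¬P = cong length (filter-none P? (universal ¬P (allVecs n m)))

  count-head : ∀ {n m} {P : Pred (Vec (Fin (suc n)) (suc m)) ℓ} (P? : Decidable P) x →
    count (λ v → P? v ×-dec (head v ≟ᶠ x)) ≡ count (λ u → P? (x ∷ u))
  count-head {n = n} P? x = begin
    count (λ v → P? v ×-dec (head v ≟ᶠ x))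
      ≡⟨ count-∷ (λ v → P? v ×-dec (head v ≟ᶠ x)) ⟩
    ∑ℕ t
      ≡⟨ ℕ∑.sum-remove {n} {x} t ⟩
    t x + ∑ℕ (λ z → t (punchIn x z))
      ≡⟨ cong₂ _+_ (count-cong (with-head x) (λ u → P? (x ∷ u)) λ u → mk⇔ proj₁ (_, refl))
                   (trans (ℕ∑.sum-cong-≗ {n} λ z →
                            count-none (with-head (punchIn x z)) λ u → punchInᵢ≢i x z ∘ proj₂)
                          (ℕ∑.sum-replicate-zero n)) ⟩
    count (λ u → P? (x ∷ u)) + 0
      ≡⟨ ℕₚ.+-identityʳ _ ⟩
    count (λ u → P? (x ∷ u)) ∎
    where
    with-head = λ y u → P? (y ∷ u) ×-dec (y ≟ᶠ x)
    t = λ y → count (with-head y)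

  avoids? : ∀ {n m} (x : Fin n) → Decidable (All (x ≢_) {m})
  avoids? x = all? (λ y → ¬? (x ≟ᶠ y))

  count-avoiding : ∀ {n m} {P : Pred (Vec (Fin (suc n)) m) ℓ} (x : Fin (suc n)) (P? : Decidable P) →
    count (λ u → avoids? x u ×-dec P? u) ≡ count (λ w → P? (map (punchIn x) w))
  count-avoiding {m = zero} x P? = trans (count-[] _) (sym (count-[] _))
  count-avoiding {n = n} {suc m} {P = P} x P? = begin
    count (λ u → avoids? x u ×-dec P? u)
      ≡⟨ count-∷ (λ u → avoids? x u ×-dec P? u) ⟩
    ∑ℕ t
      ≡⟨ ℕ∑.sum-remove {n} {x} t ⟩
    t x + ∑ℕ (λ z → t (punchIn x z))
      ≡⟨ cong₂ _+_ (count-none (after x) λ { _ ((x≢x ∷ _) , _) → x≢x refl })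
                   (ℕ∑.sum-cong-≗ {n} λ z →
                     trans (count-cong (after (punchIn x z)) (λ u → avoids? x u ×-dec P? (punchIn x z ∷ u))
                                       (forget-head z))
                           (count-avoiding x (λ u → P? (punchIn x z ∷ u)))) ⟩
    0 + ∑ℕ (λ z → count (λ w → P? (punchIn x z ∷ map (punchIn x) w)))
      ≡⟨ count-∷ (λ w → P? (map (punchIn x) w)) ⟨
    count (λ w → P? (map (punchIn x) w)) ∎
    where
    after = λ y u → avoids? x (y ∷ u) ×-dec P? (y ∷ u)
    t = λ y → count (after y)
    forget-head : ∀ z u → (All (x ≢_) (punchIn x z ∷ u) × P (punchIn x z ∷ u)) ⇔
                          (All (x ≢_) u × P (punchIn x z ∷ u))
    forget-head z u = mk⇔ (λ { ((_ ∷ x∉u) , p) → x∉u , p })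
                          (λ (x∉u , p) → ((punchInᵢ≢i x z ∘ sym) ∷ x∉u) , p)

module _ where
  open import Data.Nat using (_+_; _<ᵇ_) renaming (_≟_ to _≟ⁿ_)
  open import Data.Vec using (Vec; []; _∷_; map; head)
  open import Data.Vec.Properties using (tabulate∘lookup)
  import Data.Vec.Relation.Unary.All as All
  import Data.Vec.Relation.Unary.All.Properties as All
  open import Data.Vec.Relation.Unary.AllPairs using (allPairs?)
  open import Data.Vec.Relation.Unary.Unique.Propositional using (Unique; []; _∷_)
  import Data.Vec.Relation.Unary.Unique.Propositional.Properties as Unique
  open import Data.Fin using (zero; suc; punchIn) renaming (_≟_ to _≟ᶠ_)
  open import Data.Fin.Properties using (punchIn-injective; toℕ-injective)
  open import Data.Product using (_×_)
  open import Function.Bundles using (_⇔_; mk⇔; Equivalence)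
  open import Relation.Nullary using (Dec; ¬?; _×-dec_)
  open import Relation.Binary.PropositionalEquality using (_≢_)

  unique? : ∀ {n m} (v : Vec (Fin n) m) → Dec (Unique v)
  unique? = allPairs? (λ x y → ¬? (x ≟ᶠ y))

  IsPerm⇔Unique : ∀ {n} (v : Vec (Fin n) n) → IsPerm v ⇔ Unique v
  IsPerm⇔Unique v = mk⇔ (λ inj → subst Unique (tabulate∘lookup v) (Unique.tabulate⁺ (inj _ _)))
                        Unique.lookup-injective

  Unique-map⁻ : ∀ {A B : Set} {m} (f : A → B) {xs : Vec A m} → Unique (map f xs) → Unique xs
  Unique-map⁻ f {[]}    []       = []
  Unique-map⁻ f {_ ∷ _} (p ∷ ps) =
    All.map (λ fx≢fy x≡y → fx≢fy (cong f x≡y)) (All.map⁻ p) ∷ Unique-map⁻ f ps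

  Unique-map-punchIn : ∀ {n m} (x : Fin (suc n)) (w : Vec (Fin n) m) → Unique (map (punchIn x) w) ⇔ Unique w
  Unique-map-punchIn x w = mk⇔ (Unique-map⁻ (punchIn x)) (Unique.map⁺ (punchIn-injective x _ _))

  punchIn-<ᵇ-pivot : ∀ {n} (x : Fin (suc n)) y → (toℕ (punchIn x y) <ᵇ toℕ x) ≡ (toℕ y <ᵇ toℕ x)
  punchIn-<ᵇ-pivot zero    y       = refl
  punchIn-<ᵇ-pivot (suc x) zero    = refl
  punchIn-<ᵇ-pivot (suc x) (suc y) = punchIn-<ᵇ-pivot x y

  punchIn-<ᵇ : ∀ {n} (x : Fin (suc n)) y z →
    (toℕ (punchIn x y) <ᵇ toℕ (punchIn x z)) ≡ (toℕ y <ᵇ toℕ z)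
  punchIn-<ᵇ zero    y       z       = refl
  punchIn-<ᵇ (suc x) zero    zero    = refl
  punchIn-<ᵇ (suc x) zero    (suc z) = refl
  punchIn-<ᵇ (suc x) (suc y) zero    = refl
  punchIn-<ᵇ (suc x) (suc y) (suc z) = punchIn-<ᵇ x y z

  des : ∀ {n m} → Vec (Fin n) m → ℕ
  des v = desList (seq v)

  des-map-punchIn : ∀ {n m} (x : Fin (suc n)) (w : Vec (Fin n) m) → des (map (punchIn x) w) ≡ des w
  des-map-punchIn x []          = refl
  des-map-punchIn x (y ∷ [])    = refl
  des-map-punchIn x (y ∷ z ∷ w) =
    cong₂ (λ b e → (if b then 1 else 0) + e) (punchIn-<ᵇ x z y) (des-map-punchIn x (z ∷ w))

  des-punchIn-∷ : ∀ {n m} (x : Fin (suc n)) (w : Vec (Fin n) (suc m)) →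
    des (x ∷ map (punchIn x) w) ≡ (if toℕ (head w) <ᵇ toℕ x then 1 else 0) + des w
  des-punchIn-∷ x (y ∷ w) =
    cong₂ (λ b e → (if b then 1 else 0) + e) (punchIn-<ᵇ-pivot x y) (des-map-punchIn x (y ∷ w))

  -- ⟨ n + 1 , d ⟩ with first letter x + 1, counted by the letters after the first
  eulerianFrom : (n : ℕ) → Fin (suc n) → ℕ → ℕ
  eulerianFrom n x d = count {n = suc n} {n} λ u → unique? (x ∷ u) ×-dec (des (x ∷ u) ≟ⁿ d)

  refinedEulerian≡eulerianFrom : ∀ n x d → refinedEulerian (suc n) (+ d) (suc (toℕ x)) ≡ eulerianFrom n x d
  refinedEulerian≡eulerianFrom n x d = begin
    refinedEulerian (suc n) (+ d) (suc (toℕ x))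
      ≡⟨ refinedEulerian-count (suc n) (+ d) (suc (toℕ x)) ⟩
    count _
      ≡⟨ count-cong _ (λ v → (unique? v ×-dec (des v ≟ⁿ d)) ×-dec (head v ≟ᶠ x)) first-letter ⟩
    count (λ v → (unique? v ×-dec (des v ≟ⁿ d)) ×-dec (head v ≟ᶠ x))
      ≡⟨ count-head (λ v → unique? v ×-dec (des v ≟ⁿ d)) x ⟩
    eulerianFrom n x d ∎
    where
    first-letter : ∀ v → (IsPerm v × + Des v ≡ + d × first v ≡ suc (toℕ x)) ⇔
                         ((Unique v × des v ≡ d) × head v ≡ x)
    first-letter (y ∷ u) = mk⇔
      (λ (perm , des≡ , first≡) → (Equivalence.to (IsPerm⇔Unique (y ∷ u)) perm , ℤₚ.+-injective des≡)
                                 , toℕ-injective (ℕₚ.suc-injective first≡))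
      (λ ((uniq , des≡) , y≡x) → Equivalence.from (IsPerm⇔Unique (y ∷ u)) uniq , cong +_ des≡
                                , cong (suc ∘ toℕ) y≡x)

  eulerianFrom-offset : ∀ n y b d →
    + count {n = suc n} {n} (λ w → unique? (y ∷ w) ×-dec ((if b then 1 else 0) + des (y ∷ w) ≟ⁿ d)) ≡
    shiftWhen b (λ e → + eulerianFrom n y e) d
  eulerianFrom-offset n y false d       = refl
  eulerianFrom-offset n y true  zero    = cong +_ (count-none _ λ { _ (_ , ()) })
  eulerianFrom-offset n y true  (suc d) = cong +_ (count-cong _ _ λ w →
    mk⇔ (λ (uniq , e) → uniq , ℕₚ.suc-injective e) (λ (uniq , e) → uniq , cong suc e))

  eulerianFrom-suc : ∀ n x d →
    + eulerianFrom (suc n) x d ≡ ∑ℤ λ y → shiftWhen (toℕ y <ᵇ toℕ x) (λ e → + eulerianFrom n y e) d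
  eulerianFrom-suc n x d = begin
    + count (λ u → unique? (x ∷ u) ×-dec (des (x ∷ u) ≟ⁿ d))
      ≡⟨ cong +_ (count-cong _ (λ u → avoids? x u ×-dec (unique? u ×-dec (des (x ∷ u) ≟ⁿ d)))
                             unique-∷) ⟩
    + count (λ u → avoids? x u ×-dec (unique? u ×-dec (des (x ∷ u) ≟ⁿ d)))
      ≡⟨ cong +_ (count-avoiding x (λ u → unique? u ×-dec (des (x ∷ u) ≟ⁿ d))) ⟩
    + count (λ w → unique? (map (punchIn x) w) ×-dec (des (x ∷ map (punchIn x) w) ≟ⁿ d))
      ≡⟨ cong +_ (count-cong _ (λ w → unique? w ×-dec (step (head w) + des w ≟ⁿ d)) standardise) ⟩
    + count (λ w → unique? w ×-dec (step (head w) + des w ≟ⁿ d))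
      ≡⟨ cong +_ (count-∷ (λ w → unique? w ×-dec (step (head w) + des w ≟ⁿ d))) ⟩
    + ∑ℕ by-second-letter
      ≡⟨ pos-∑ by-second-letter ⟩
    ∑ℤ (λ y → + by-second-letter y)
      ≡⟨ ℤ∑.sum-cong-≗ {suc n} (λ y → eulerianFrom-offset n y (toℕ y <ᵇ toℕ x) d) ⟩
    ∑ℤ (λ y → shiftWhen (toℕ y <ᵇ toℕ x) (λ e → + eulerianFrom n y e) d) ∎
    where
    step = λ (y : Fin (suc n)) → if toℕ y <ᵇ toℕ x then 1 else 0
    by-second-letter : Fin (suc n) → ℕ
    by-second-letter y = count {n = suc n} {n} λ w → unique? (y ∷ w) ×-dec (step y + des (y ∷ w) ≟ⁿ d)
    unique-∷ : ∀ u → (Unique (x ∷ u) × des (x ∷ u) ≡ d) ⇔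
                     (All.All (x ≢_) u × Unique u × des (x ∷ u) ≡ d)
    unique-∷ u = mk⇔ (λ { ((x∉u ∷ uniq) , e) → x∉u , uniq , e })
                     (λ (x∉u , uniq , e) → (x∉u ∷ uniq) , e)
    standardise : ∀ w → (Unique (map (punchIn x) w) × des (x ∷ map (punchIn x) w) ≡ d) ⇔
                        (Unique w × step (head w) + des w ≡ d)
    standardise w = mk⇔
      (λ (uniq , e) → Equivalence.to (Unique-map-punchIn x w) uniq , trans (sym (des-punchIn-∷ x w)) e)
      (λ (uniq , e) → Equivalence.from (Unique-map-punchIn x w) uniq , trans (des-punchIn-∷ x w) e)

  eulerianFrom-zero : ∀ d → + eulerianFrom 0 zero d ≡ Δ (λ _ → + 1) d
  eulerianFrom-zero zero    = cong +_ (count-[] _)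
  eulerianFrom-zero (suc d) = cong +_ (count-[] _)

  eulerianFrom≡eulerianFormula : ∀ n x d → + eulerianFrom n x d ≡ eulerianFormula n x d
  eulerianFrom≡eulerianFormula zero    zero d = trans (eulerianFrom-zero d) (sym (eulerianFormula-zero d))
  eulerianFrom≡eulerianFormula (suc n) x    d = begin
    + eulerianFrom (suc n) x d
      ≡⟨ eulerianFrom-suc n x d ⟩
    ∑ℤ (λ y → shiftWhen (toℕ y <ᵇ toℕ x) (λ e → + eulerianFrom n y e) d)
      ≡⟨ ℤ∑.sum-cong-≗ {suc n} (λ y →
           shiftWhen-cong (toℕ y <ᵇ toℕ x) (eulerianFrom≡eulerianFormula n y) d) ⟩
    ∑ℤ (λ y → shiftWhen (toℕ y <ᵇ toℕ x) (eulerianFormula n y) d)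
      ≡⟨ eulerianFormula-suc n x d ⟨
    eulerianFormula (suc n) x d ∎

theorem1 : (n k : ℕ) (d : ℤ) → 1 ≤ n → 1 ≤ k → k ≤ n →
    + (refinedEulerian n d k) ≡ rhs n d k
theorem1 n k -[1+ m ] _ _ _ = begin
  + refinedEulerian n -[1+ m ] k   ≡⟨ cong +_ (refinedEulerian-count n -[1+ m ] k) ⟩
  + count _                        ≡⟨ cong +_ (count-none _ λ { _ (_ , () , _) }) ⟩
  + 0                              ≡⟨ rhs-neg n m k ⟨
  rhs n -[1+ m ] k                 ∎
theorem1 (suc n) (suc p) (+ d) _ _ (s≤s p≤n) =
  subst (λ k → + refinedEulerian (suc n) (+ d) (suc k) ≡ rhs (suc n) (+ d) (suc k))
        (toℕ-fromℕ< (s≤s p≤n)) for-first-letter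
  where
  x = fromℕ< (s≤s p≤n)
  for-first-letter : + refinedEulerian (suc n) (+ d) (suc (toℕ x)) ≡ rhs (suc n) (+ d) (suc (toℕ x))
  for-first-letter = begin
    + refinedEulerian (suc n) (+ d) (suc (toℕ x))  ≡⟨ cong +_ (refinedEulerian≡eulerianFrom n x d) ⟩
    + eulerianFrom n x d                           ≡⟨ eulerianFrom≡eulerianFormula n x d ⟩
    eulerianFormula n x d                          ≡⟨ rhs-pos (suc n) d (suc (toℕ x)) ⟨
    rhs (suc n) (+ d) (suc (toℕ x))                ∎
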